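{- Let $F\colon (L+\{\tau\})\to[S\to\mathcal P S]$ be a labelled transition system with internal action $\tau$, and $F^{sb}$ its semi-branching saturation. Then $\eta_S\le F^{sb}(\tau)$ and $F^{sb}(\tau)\cdot F^{sb}(\tau)\le F^{sb}(\tau)$ (so $F^{sb}(\tau)$ is a left-semi-monoid in $[S\to\mathcal P(S\times S)]$), and for every $a\in L$, $F^{sb}(\tau)\cdot F^{sb}(a)\le F^{sb}(a)$ (so $F^{sb}(a)$ is a left $F^{sb}(\tau)$-module).
   Context: $L$ is a set of labels not containing $\tau$; write $s\xrightarrow{a}s'$ for $s'\in F(a)(s)$, and $x\xrightarrow{\tau^*}y$ iff there is a finite possibly empty chain $x\xrightarrow{\tau}\cdots\xrightarrow{\tau}y$ (with $x=y$ if empty). $F^{sb}\colon (L+\{\tau\})\to[S\to\mathcal P(S\times S)]$ is $F^{sb}(a)(s)=\{(s_1,s_2)\mid s\xrightarrow{\tau^*}s_1\xrightarrow{a}s_2,\text{ or }(a=\tau,\ s_1=s_2,\ s\xrightarrow{\tau^*}s_1)\}$. On $[S\to\mathcal P(S\times S)]$: $\eta_S(s)=\{(s,s)\}$; $(f\cdot g)(s)=\bigcup_{(x,y)\in f(s)}(g(x)\cup g(y))$; $f\le g$ iff $f(s)\subseteq g(s)$ for all $s$. -}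

module Defs where

open import Level using (Level; 0ℓ)
open import Data.Product using (Σ; _×_; _,_; ∃-syntax)
open import Data.Sum using (_⊎_; inj₁; inj₂)
open import Data.Unit using (⊤; tt)
open import Relation.Binary.PropositionalEquality using (_≡_)

𝒫 : Set → Set₁
𝒫 A = A → Set

Act : Set → Set
Act L = L ⊎ ⊤

τ : {L : Set} → Act L
τ = inj₂ tt

LTS : Set → Set → Set₁
LTS L S = Act L → S → 𝒫 S

_⊢_-[_]->_ : {L S : Set} → LTS L S → S → Act L → S → Set
F ⊢ s -[ a ]-> s' = F a s s'

data TauStar {L S : Set} (F : LTS L S) : S → S → Set where
  τ-refl : ∀ {x} → TauStar F x x
  τ-step : ∀ {x y z} → F τ x y → TauStar F y z → TauStar F x z

Arr : Set → Set₁
Arr S = S → 𝒫 (S × S)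

Fsb : {L S : Set} → LTS L S → Act L → Arr S
Fsb F a s (s₁ , s₂) =
  (TauStar F s s₁ × F a s₁ s₂) ⊎ ((a ≡ τ) × (s₁ ≡ s₂) × TauStar F s s₁)

ηS : {S : Set} → Arr S
ηS s (x , y) = (x ≡ s) × (y ≡ s)

_·_ : {S : Set} → Arr S → Arr S → Arr S
(f · g) s p = Σ _ λ x → Σ _ λ y → f s (x , y) × (g x p ⊎ g y p)

_≤A_ : {S : Set} → Arr S → Arr S → Set
f ≤A g = ∀ s p → f s p → g s p

module Submission where

open import Defs
open import Data.Product using (_×_; _,_)
open import Data.Sum using (inj₁; inj₂)
open import Relation.Binary.PropositionalEquality using (refl)

-- Both components of a pair in F^sb(τ)(s) are τ*-reachable from s, and F^sb(b)
-- is closed under τ*-prefixing; so whichever component the composite continues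
-- from, the result is again in F^sb(b)(s).

module _ {L S : Set} (F : LTS L S) where

  τ*-trans : ∀ {x y z} → TauStar F x y → TauStar F y z → TauStar F x z
  τ*-trans τ-refl         q = q
  τ*-trans (τ-step st r) q = τ-step st (τ*-trans r q)

  τ*-snoc : ∀ {x y z} → TauStar F x y → F τ y z → TauStar F x z
  τ*-snoc r st = τ*-trans r (τ-step st τ-refl)

  Fsbτ⇒τ*ˡ : ∀ {s x y} → Fsb F τ s (x , y) → TauStar F s x
  Fsbτ⇒τ*ˡ (inj₁ (r , _))     = r
  Fsbτ⇒τ*ˡ (inj₂ (_ , _ , r)) = r

  Fsbτ⇒τ*ʳ : ∀ {s x y} → Fsb F τ s (x , y) → TauStar F s y
  Fsbτ⇒τ*ʳ (inj₁ (r , st))       = τ*-snoc r st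
  Fsbτ⇒τ*ʳ (inj₂ (_ , refl , r)) = r

  Fsb-τ*-prefix : ∀ {b s x p} → TauStar F s x → Fsb F b x p → Fsb F b s p
  Fsb-τ*-prefix r (inj₁ (r′ , st))     = inj₁ (τ*-trans r r′ , st)
  Fsb-τ*-prefix r (inj₂ (e , e′ , r′)) = inj₂ (e , e′ , τ*-trans r r′)

  ηS≤Fsbτ : ηS ≤A Fsb F τ
  ηS≤Fsbτ s (x , y) (refl , refl) = inj₂ (refl , refl , τ-refl)

  Fsbτ·Fsb≤Fsb : ∀ b → (Fsb F τ · Fsb F b) ≤A Fsb F b
  Fsbτ·Fsb≤Fsb b s p (x , y , sxy , inj₁ q) = Fsb-τ*-prefix (Fsbτ⇒τ*ˡ sxy) q
  Fsbτ·Fsb≤Fsb b s p (x , y , sxy , inj₂ q) = Fsb-τ*-prefix (Fsbτ⇒τ*ʳ sxy) q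

mainTheorem14 : {L S : Set} (F : LTS L S) →
    (ηS ≤A Fsb F τ)
    × ((Fsb F τ · Fsb F τ) ≤A Fsb F τ)
    × (∀ (a : L) → (Fsb F τ · Fsb F (inj₁ a)) ≤A Fsb F (inj₁ a))
mainTheorem14 F = ηS≤Fsbτ F , Fsbτ·Fsb≤Fsb F τ , λ a → Fsbτ·Fsb≤Fsb F (inj₁ a)
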